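{- Let $A$ and $B = \{b_1 < b_2 < b_3 < \cdots\}$ be two infinite sequences of positive integers with $b_1 > 1$ such that $P(A) = \mathbb{N} \setminus B$. If $3b_1 + 5 \leq b_2 \leq 6b_1 + 10$, then $b_3 \geq b_2 + b_1 + 1$.
   Context: $\mathbb{N}$ denotes the set of all nonnegative integers. For a set $A = \{a_1 < a_2 < \cdots\}$ of positive integers, $P(A) = \{\sum \varepsilon_i a_i : a_i \in A,\ \varepsilon_i \in \{0,1\},\ \sum \varepsilon_i < \infty\}$ is the set of all finite subset sums of $A$; in particular $0 \in P(A)$ (empty sum). -}

module Defs where

open import Data.Nat using (ℕ; zero; suc; _+_; _<_)
open import Data.Bool using (Bool; true; false)
open import Data.Vec using (Vec; []; _∷_)
open import Relation.Binary.PropositionalEquality using (_≡_)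
open import Data.Product using (∃; ∃-syntax; Σ-syntax)

-- A sequence a : ℕ → ℕ (0-indexed: a 0 = a₁, a 1 = a₂, ...) is strictly increasing.
StrictlyIncreasing : (ℕ → ℕ) → Set
StrictlyIncreasing a = ∀ i j → i < j → a i < a j

selSum : (ℕ → ℕ) → ∀ {k} → Vec Bool k → ℕ
selSum a [] = 0
selSum a (true ∷ es) = a 0 + selSum (λ i → a (suc i)) es
selSum a (false ∷ es) = selSum (λ i → a (suc i)) es

-- n ∈ P(A): n is a finite subset sum of the terms of a (empty sum = 0 allowed).
InP : (ℕ → ℕ) → ℕ → Set
InP a n = ∃[ k ] Σ[ ε ∈ Vec Bool k ] selSum a ε ≡ n

InSeq : (ℕ → ℕ) → ℕ → Set
InSeq b n = ∃[ i ] b i ≡ n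

{-# OPTIONS --safe #-}
-- Write s_j = a 0 + ⋯ + a (j - 1) and suppose b 2 ≤ b 1 + b 0. As long as a j ≤ s_j + 2 at every step,
-- induction on j shows that every z < b 0 up to s_j is a sum of the first j terms, and that no two
-- non-sums x < y ≤ x + b 0 of them lie below s_j; the latter, for x = b 1 and y = b 2, gives s_j < b 2.
-- As s_j is unbounded, some a k > s_k + 2. Then s_k + 1 and s_k + 2 are in B, which forces b 1 ≤ s_k + 1
-- because b 1 > 2 b 0 + 1. By the symmetry z ↦ s_k ∸ z of sums of the first k terms, s_k ∸ b 0 is in B
-- too, yet it is neither b 0 nor at least b 1, since s_k < b 2 ≤ b 1 + b 0.
module Submission where

open import Defs
open import Data.Nat using (ℕ; zero; suc; _+_; _*_; _∸_; _≤_; _<_; _≥_; z≤n; s≤s; z<s; _≤?_; _≟_)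
open import Data.Nat.Properties
open import Data.Bool using (Bool; true; false; if_then_else_)
open import Data.Vec using (Vec; []; _∷_; _∷ʳ_)
open import Data.Product using (Σ; _,_; _×_; proj₂)
open import Data.Sum using (inj₁; inj₂)
open import Data.Empty using (⊥; ⊥-elim)
open import Function using (_∘_)
open import Function.Bundles using (_⇔_; Equivalence)
open import Relation.Nullary using (¬_; yes; no; contradiction)
open import Relation.Binary.PropositionalEquality

variable
  a : ℕ → ℕ
  j k z : ℕ

prefixSum : (ℕ → ℕ) → ℕ → ℕ
prefixSum a zero = 0
prefixSum a (suc j) = prefixSum a j + a j

data SubsetSum (a : ℕ → ℕ) : ℕ → ℕ → Set where
  []   : SubsetSum a 0 0
  skip : SubsetSum a j z → SubsetSum a (suc j) z
  take : SubsetSum a j z → SubsetSum a (suc j) (z + a j)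

subsetSum-shift-skip : SubsetSum (a ∘ suc) j z → SubsetSum a (suc j) z
subsetSum-shift-skip [] = skip []
subsetSum-shift-skip (skip p) = skip (subsetSum-shift-skip p)
subsetSum-shift-skip (take p) = take (subsetSum-shift-skip p)

subsetSum-shift-take : SubsetSum (a ∘ suc) j z → SubsetSum a (suc j) (a 0 + z)
subsetSum-shift-take {a} [] = subst (SubsetSum a 1) (+-comm 0 (a 0)) (take [])
subsetSum-shift-take (skip p) = skip (subsetSum-shift-take p)
subsetSum-shift-take {a} (take {z = z} p) =
  subst (SubsetSum a _) (+-assoc (a 0) z _) (take (subsetSum-shift-take p))

selSum⇒subsetSum : (ε : Vec Bool k) → SubsetSum a k (selSum a ε)
selSum⇒subsetSum [] = []
selSum⇒subsetSum (true ∷ ε) = subsetSum-shift-take (selSum⇒subsetSum ε)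
selSum⇒subsetSum (false ∷ ε) = subsetSum-shift-skip (selSum⇒subsetSum ε)

selSum-∷ʳ : ∀ a (ε : Vec Bool k) β → selSum a (ε ∷ʳ β) ≡ selSum a ε + (if β then a k else 0)
selSum-∷ʳ a [] true = +-identityʳ (a 0)
selSum-∷ʳ a [] false = refl
selSum-∷ʳ a (true ∷ ε) β =
  trans (cong (a 0 +_) (selSum-∷ʳ (a ∘ suc) ε β)) (sym (+-assoc (a 0) _ _))
selSum-∷ʳ a (false ∷ ε) β = selSum-∷ʳ (a ∘ suc) ε β

subsetSum⇒selSum : SubsetSum a k z → Σ (Vec Bool k) (λ ε → selSum a ε ≡ z)
subsetSum⇒selSum [] = [] , refl
subsetSum⇒selSum {a} (skip p) with subsetSum⇒selSum p
... | ε , refl = ε ∷ʳ false , trans (selSum-∷ʳ a ε false) (+-identityʳ _)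
subsetSum⇒selSum {a} (take p) with subsetSum⇒selSum p
... | ε , refl = ε ∷ʳ true , selSum-∷ʳ a ε true

subsetSum⇒InP : SubsetSum a k z → InP a z
subsetSum⇒InP {k = k} p = k , subsetSum⇒selSum p

subsetSum≤prefixSum : SubsetSum a k z → z ≤ prefixSum a k
subsetSum≤prefixSum [] = z≤n
subsetSum≤prefixSum {a} (skip {j} p) = ≤-trans (subsetSum≤prefixSum p) (m≤m+n _ (a j))
subsetSum≤prefixSum {a} (take {j} p) = +-monoˡ-≤ (a j) (subsetSum≤prefixSum p)

subsetSum-complement : SubsetSum a k z → SubsetSum a k (prefixSum a k ∸ z)
subsetSum-complement [] = []
subsetSum-complement {a} (skip {j} p) =
  subst (SubsetSum a _) (sym (+-∸-comm (a j) (subsetSum≤prefixSum p))) (take (subsetSum-complement p))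
subsetSum-complement {a} (take {j} {z} p) =
  subst (SubsetSum a _) (sym (cancel (prefixSum a j))) (skip (subsetSum-complement p))
  where
  cancel : ∀ s → s + a j ∸ (z + a j) ≡ s ∸ z
  cancel s = trans (cong₂ _∸_ (+-comm s (a j)) (+-comm z (a j))) ([m+n]∸[m+o]≡n∸o (a j) s z)

subsetSum-extend : j ≤ k → SubsetSum a j z → SubsetSum a k z
subsetSum-extend {j} {k} j≤k p with m≤n⇒m<n∨m≡n j≤k
subsetSum-extend {k = suc k} j≤k p | inj₁ j<k = skip (subsetSum-extend (≤-pred j<k) p)
... | inj₂ refl = p

strictlyIncreasing⇒monotone : ∀ {f} → StrictlyIncreasing f → ∀ {i j} → i ≤ j → f i ≤ f j
strictlyIncreasing⇒monotone inc {i} {j} i≤j with m≤n⇒m<n∨m≡n i≤j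
... | inj₁ i<j = <⇒≤ (inc i j i<j)
... | inj₂ refl = ≤-refl

-- A sum below a k cannot use a k or any later (larger) term.
subsetSum-restrict : StrictlyIncreasing a → SubsetSum a j z → z < a k → SubsetSum a k z
subsetSum-restrict inc [] _ = subsetSum-extend z≤n []
subsetSum-restrict {k = k} inc (skip {i} p) z<ak with k ≤? i
... | yes _ = subsetSum-restrict inc p z<ak
... | no k≰i = subsetSum-extend (≰⇒> k≰i) (skip p)
subsetSum-restrict {a} {k = k} inc (take {i} {z} p) z+ai<ak with k ≤? i
... | yes k≤i = contradiction (≤-trans (strictlyIncreasing⇒monotone inc k≤i) (m≤n+m (a i) z)) (<⇒≱ z+ai<ak)
... | no k≰i = subsetSum-extend (≰⇒> k≰i) (take p)

InP⇒subsetSum : StrictlyIncreasing a → InP a z → z < a k → SubsetSum a k z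
InP⇒subsetSum {a} inc (_ , ε , refl) z<ak = subsetSum-restrict inc (selSum⇒subsetSum ε) z<ak

InP-beyond-prefixSum : StrictlyIncreasing a → prefixSum a k < z → z < a k → ¬ InP a z
InP-beyond-prefixSum inc s<z z<ak r = <⇒≱ s<z (subsetSum≤prefixSum (InP⇒subsetSum inc r z<ak))

InP-complement : StrictlyIncreasing a → prefixSum a k < a k → z ≤ prefixSum a k
               → InP a (prefixSum a k ∸ z) → InP a z
InP-complement {a} {k} {z} inc s<ak z≤s r =
  subsetSum⇒InP (subst (SubsetSum a k) (m∸[m∸n]≡n z≤s)
    (subsetSum-complement (InP⇒subsetSum inc r (≤-<-trans (m∸n≤m (prefixSum a k) z) s<ak))))

n≤prefixSum : (∀ i → 1 ≤ a i) → ∀ n → n ≤ prefixSum a n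
n≤prefixSum pos zero = z≤n
n≤prefixSum {a} pos (suc n) = subst (_≤ prefixSum a n + a n) (+-comm n 1) (+-mono-≤ (n≤prefixSum pos n) (pos n))

take-∸ : a j ≤ z → SubsetSum a j (z ∸ a j) → SubsetSum a (suc j) z
take-∸ {a} aj≤z p = subst (SubsetSum a _) (m∸n+n≡m aj≤z) (take p)

m≤n+o⇒m∸o≤n : ∀ {m n o} → m ≤ n + o → m ∸ o ≤ n
m≤n+o⇒m∸o≤n {m} {n} {o} m≤n+o = m≤n+o⇒m∸n≤o m o (subst (m ≤_) (+-comm n o) m≤n+o)

n≤m∧m<n+o⇒m∸n<o : ∀ {m n o} → n ≤ m → m < n + o → m ∸ n < o
n≤m∧m<n+o⇒m∸n<o {m} {n} n≤m m<n+o = +-cancelˡ-< n _ _ (subst (_< n + _) (sym (m+[n∸m]≡n n≤m)) m<n+o)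

module PrefixInvariants {a : ℕ → ℕ} (inc : StrictlyIncreasing a) {m : ℕ}
                        (small : ∀ {z} → z < m → InP a z) where

  SmallSumsRepresented : ℕ → Set
  SmallSumsRepresented j = ∀ {z} → z < m → z ≤ prefixSum a j → SubsetSum a j z

  NoNearbyNonSums : ℕ → Set
  NoNearbyNonSums j = ∀ {x y} → x < y → y ≤ x + m → y ≤ prefixSum a j
                    → ¬ SubsetSum a j x → ¬ SubsetSum a j y → ⊥

  Invariant : ℕ → Set
  Invariant j = SmallSumsRepresented j × NoNearbyNonSums j

  small-base : SmallSumsRepresented 0
  small-base {zero} _ _ = []

  nearby-base : NoNearbyNonSums 0
  nearby-base x<y _ y≤0 _ _ = <⇒≱ (≤-<-trans z≤n x<y) y≤0

  small-step : SmallSumsRepresented j → SmallSumsRepresented (suc j)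
  small-step {j} L {z} z<m z≤s+aj with z ≤? prefixSum a j | a j ≤? z
  ... | yes z≤s | _ = skip (L z<m z≤s)
  ... | no _ | yes aj≤z = take-∸ aj≤z (L (≤-<-trans (m∸n≤m z (a j)) z<m) (m≤n+o⇒m∸o≤n z≤s+aj))
  ... | no z≰s | no aj≰z = ⊥-elim (InP-beyond-prefixSum inc (≰⇒> z≰s) (≰⇒> aj≰z) (small z<m))

  nearby-step : a j ≤ prefixSum a j + 2 → SmallSumsRepresented j → NoNearbyNonSums j
              → NoNearbyNonSums (suc j)
  nearby-step {j} aj≤s+2 L H {x} {y} x<y y≤x+m y≤s+aj x∉ y∉
    with y ≤? prefixSum a j | a j ≤? x | a j ≤? y
  ... | yes y≤s | _ | _ = H x<y y≤x+m y≤s (x∉ ∘ skip) (y∉ ∘ skip)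
  ... | no _ | yes aj≤x | _ =
    H (∸-monoˡ-< x<y aj≤x) shifted-close shifted-bound (x∉ ∘ take-∸ aj≤x) (y∉ ∘ take-∸ aj≤y)
    where
    aj≤y : a j ≤ y
    aj≤y = ≤-trans aj≤x (<⇒≤ x<y)
    shifted-close : y ∸ a j ≤ x ∸ a j + m
    shifted-close = subst (y ∸ a j ≤_) (+-∸-comm m aj≤x) (∸-monoˡ-≤ (a j) y≤x+m)
    shifted-bound : y ∸ a j ≤ prefixSum a j
    shifted-bound = m≤n+o⇒m∸o≤n y≤s+aj
  ... | no _ | no aj≰x | yes aj≤y =
    y∉ (take-∸ aj≤y (L y∸aj<m (m≤n+o⇒m∸o≤n y≤s+aj)))
    where
    y∸aj<m : y ∸ a j < m
    y∸aj<m = n≤m∧m<n+o⇒m∸n<o aj≤y (≤-<-trans y≤x+m (+-monoˡ-< m (≰⇒> aj≰x)))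
  -- Both x and y lie below a j, so x is the complement of a small sum.
  ... | no y≰s | no _ | no aj≰y =
    x∉ (skip (subst (SubsetSum a j) (m∸[m∸n]≡n x≤s) (subsetSum-complement (L s∸x<m (m∸n≤m _ x)))))
    where
    x≤s : x ≤ prefixSum a j
    x≤s = ≤-pred (≤-pred (subst (2 + x ≤_) (+-comm _ 2) (≤-trans (s≤s x<y) (≤-trans (≰⇒> aj≰y) aj≤s+2))))
    s∸x<m : prefixSum a j ∸ x < m
    s∸x<m = n≤m∧m<n+o⇒m∸n<o x≤s (<-≤-trans (≰⇒> y≰s) y≤x+m)

  invariant : (∀ {j} → Invariant j → a j ≤ prefixSum a j + 2) → ∀ j → Invariant j
  invariant no-jump zero = small-base , nearby-base
  invariant no-jump (suc j) with invariant no-jump j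
  ... | L , H = small-step L , nearby-step (no-jump (L , H)) L H

module Partition {a b : ℕ → ℕ} (a-inc : StrictlyIncreasing a) (b-inc : StrictlyIncreasing b)
                  (partition : ∀ n → InP a n ⇔ (¬ InSeq b n)) where

  b-nonSum : ∀ i → ¬ InP a (b i)
  b-nonSum i r = Equivalence.to (partition (b i)) r (i , refl)

  below-b0⇒InP : z < b 0 → InP a z
  below-b0⇒InP {z} z<b0 = Equivalence.from (partition z) z∉B
    where
    z∉B : ¬ InSeq b z
    z∉B (i , bi≡z) = <⇒≱ z<b0 (subst (b 0 ≤_) bi≡z (strictlyIncreasing⇒monotone b-inc z≤n))

  nonSum⇒b1≤ : ¬ InP a z → z ≢ b 0 → b 1 ≤ z
  nonSum⇒b1≤ {z} z∉P z≢b0 with b 1 ≤? z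
  ... | yes b1≤z = b1≤z
  ... | no b1≰z = ⊥-elim (z∉P (Equivalence.from (partition z) z∉B))
    where
    z∉B : ¬ InSeq b z
    z∉B (zero , b0≡z) = z≢b0 (sym b0≡z)
    z∉B (suc i , bi≡z) = b1≰z (subst (b 1 ≤_) bi≡z (strictlyIncreasing⇒monotone b-inc (s≤s z≤n)))

  consecutive-nonSums⇒b1≤ : suc (b 0) < b 1 → ¬ InP a z → ¬ InP a (suc z) → b 1 ≤ z
  consecutive-nonSums⇒b1≤ {z} 1+b0<b1 z∉P 1+z∉P with z ≟ b 0
  ... | no z≢b0 = nonSum⇒b1≤ z∉P z≢b0
  ... | yes refl = ⊥-elim (<⇒≱ 1+b0<b1 (nonSum⇒b1≤ 1+z∉P (1+n≢n {b 0})))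

  module _ (a0-pos : 1 ≤ a 0) (b1-large : 2 * b 0 + 1 < b 1) (b2-small : b 2 ≤ b 1 + b 0) where
    open PrefixInvariants a-inc below-b0⇒InP

    prefixSum<b2 : NoNearbyNonSums k → prefixSum a k < b 2
    prefixSum<b2 H = ≰⇒> λ b2≤s →
      H (b-inc 1 2 (s≤s (s≤s z≤n))) b2-small b2≤s (b-nonSum 1 ∘ subsetSum⇒InP) (b-nonSum 2 ∘ subsetSum⇒InP)

    -- s ∸ b 0 is a non-sum by symmetry, so it is b 0 or at least b 1; the former would give s + 1 = 2 b 0 + 1 < b 1.
    b1+b0≤prefixSum : prefixSum a k < a k → b 1 ≤ suc (prefixSum a k) → b 1 + b 0 ≤ prefixSum a k
    b1+b0≤prefixSum {k} s<ak b1≤1+s =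
      subst (b 1 + b 0 ≤_) (m∸n+n≡m b0≤s) (+-monoˡ-≤ (b 0) (nonSum⇒b1≤ s∸b0∉P s∸b0≢b0))
      where
      s : ℕ
      s = prefixSum a k
      b0≤s : b 0 ≤ s
      b0≤s = ≤-pred (<-≤-trans (b-inc 0 1 z<s) b1≤1+s)
      s∸b0∉P : ¬ InP a (s ∸ b 0)
      s∸b0∉P r = b-nonSum 0 (InP-complement a-inc s<ak b0≤s r)
      s∸b0≢b0 : s ∸ b 0 ≢ b 0
      s∸b0≢b0 e = <⇒≱ b1-large (subst (λ t → b 1 ≤ t + 1) s≡2*b0 (subst (b 1 ≤_) (+-comm 1 s) b1≤1+s))
        where
        s≡2*b0 : s ≡ 2 * b 0
        s≡2*b0 = trans (sym (m∸n+n≡m b0≤s)) (trans (cong (_+ b 0) e) (cong (b 0 +_) (sym (+-identityʳ (b 0)))))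

    -- Otherwise s + 1 and s + 2 are consecutive non-sums.
    no-jump : Invariant k → a k ≤ prefixSum a k + 2
    no-jump {k} (_ , H) with a k ≤? prefixSum a k + 2
    ... | yes ak≤s+2 = ak≤s+2
    ... | no ak≰s+2 = ⊥-elim (<⇒≱ (prefixSum<b2 H) (≤-trans b2-small (b1+b0≤prefixSum s<ak b1≤1+s)))
      where
      s : ℕ
      s = prefixSum a k
      2+s<ak : 2 + s < a k
      2+s<ak = subst (_< a k) (+-comm s 2) (≰⇒> ak≰s+2)
      s<ak : s < a k
      s<ak = ≤-<-trans (m≤n+m s 2) 2+s<ak
      b1≤1+s : b 1 ≤ suc s
      b1≤1+s = consecutive-nonSums⇒b1≤ 1+b0<b1
        (InP-beyond-prefixSum {k = k} a-inc ≤-refl (<-trans (n<1+n (suc s)) 2+s<ak))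
        (InP-beyond-prefixSum {k = k} a-inc (<-trans (n<1+n s) (n<1+n (suc s))) 2+s<ak)
        where
        1+b0<b1 : suc (b 0) < b 1
        1+b0<b1 = ≤-<-trans (s≤s (m≤m+n (b 0) (b 0 + 0))) (subst (_< b 1) (+-comm (2 * b 0) 1) b1-large)

    absurd : ⊥
    absurd = <⇒≱ (prefixSum<b2 (proj₂ (invariant no-jump (b 2)))) (n≤prefixSum a-pos (b 2))
      where
      a-pos : ∀ i → 1 ≤ a i
      a-pos i = ≤-trans a0-pos (strictlyIncreasing⇒monotone a-inc z≤n)

  b1+b0<b2 : 1 ≤ a 0 → 2 * b 0 + 1 < b 1 → b 1 + b 0 < b 2
  b1+b0<b2 a0-pos b1-large = ≰⇒> (absurd a0-pos b1-large)

theorem1p1 : (a b : ℕ → ℕ)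
    → StrictlyIncreasing a → 1 ≤ a 0
    → StrictlyIncreasing b → 1 < b 0
    → (∀ n → InP a n ⇔ (¬ InSeq b n))
    → 3 * b 0 + 5 ≤ b 1 → b 1 ≤ 6 * b 0 + 10
    → b 2 ≥ b 1 + b 0 + 1
theorem1p1 a b a-inc a0-pos b-inc _ partition 3b0+5≤b1 _ =
  subst (_≤ b 2) (+-comm 1 (b 1 + b 0)) (Partition.b1+b0<b2 a-inc b-inc partition a0-pos b1-large)
  where
  b1-large : 2 * b 0 + 1 < b 1
  b1-large = <-≤-trans (+-mono-≤-< (*-monoˡ-≤ (b 0) {2} {3} (s≤s (s≤s z≤n))) (s≤s (s≤s z≤n))) 3b0+5≤b1
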